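{- Let $k\ge 2$ be an integer, and let $G$ be a graph all of whose anticonnected components have fewer than $|G|/k$ vertices. Then there is a complete $(k,|G|/k^2)$-blockade in $G$.
   Context: Graphs are finite and simple; $|G|$ is the number of vertices and $\overline G$ the complement. $G$ is anticonnected if $\overline G$ is connected; an induced subgraph $F$ of $G$ is an anticonnected component of $G$ if $\overline F$ is a connected component of $\overline G$. A blockade in $G$ is a sequence $(B_1,\dots,B_m)$ of pairwise disjoint subsets of $V(G)$, of length $m$ and width $\min_i|B_i|$; it is an $(\ell,w)$-blockade if its length is at least $\ell$ and width at least $w$; it is complete if for all distinct $i,j$ every vertex of $B_i$ is adjacent to every vertex of $B_j$. -}

module Defs where

open import Data.Nat using (ℕ; _*_; _<_; _≤_)
open import Data.Bool using (Bool; true; false)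
open import Data.Fin using (Fin)
open import Data.Fin.Subset using (Subset; _∈_; _∉_; ∣_∣)
open import Data.Product using (Σ; ∃; _×_; _,_)
open import Relation.Binary.PropositionalEquality using (_≡_; _≢_)

record Graph (n : ℕ) : Set where
  field
    adj     : Fin n → Fin n → Bool
    sym     : ∀ u v → adj u v ≡ adj v u
    irrefl  : ∀ v → adj v v ≡ false
open Graph public

CoAdj : ∀ {n} → Graph n → Fin n → Fin n → Set
CoAdj G u v = (u ≢ v) × (adj G u v ≡ false)

data CoReach {n} (G : Graph n) (u : Fin n) : Fin n → Set where
  here : CoReach G u u
  step : ∀ {v w} → CoReach G u v → CoAdj G v w → CoReach G u w

-- Every anticonnected component of G has fewer than |G|/k vertices:
-- for every vertex v, every set of vertices contained in the anticonnected
-- component of v has size s with s < n / k, i.e. k * s < n.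
SmallAnticomponents : ∀ {n} → Graph n → ℕ → Set
SmallAnticomponents {n} G k =
  ∀ (v : Fin n) (S : Subset n) → (∀ u → u ∈ S → CoReach G v u) → k * ∣ S ∣ < n

record Blockade {n} (G : Graph n) : Set where
  field
    len      : ℕ
    block    : Fin len → Subset n
    disjoint : ∀ i j → i ≢ j → ∀ u → u ∈ block i → u ∉ block j

open Blockade public

-- width ≥ w, stated as a rational bound n / d ≤ |B_i|, i.e. n ≤ d * |B_i|
WidthAtLeastFrac : ∀ {n} {G : Graph n} → Blockade G → ℕ → Set
WidthAtLeastFrac {n} B d = ∀ i → n ≤ d * ∣ block B i ∣

Complete : ∀ {n} {G : Graph n} → Blockade G → Set
Complete {G = G} B =
  ∀ i j → i ≢ j → ∀ u v → u ∈ block B i → v ∈ block B j → adj G u v ≡ true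

{-# OPTIONS --safe #-}
-- Call a vertex set co-closed if it is a union of anticomponents; every vertex of a co-closed
-- set E is then adjacent to every vertex outside E. Starting from C₀ = ∅, grow co-closed sets
-- C₀ ⊆ C₁ ⊆ ⋯ ⊆ C_{k-1} by adding whole anticomponents, stopping as soon as
-- |C_{i+1} ∖ C_i| ≥ n/k². Each anticomponent has fewer than n/k vertices, so every step
-- overshoots by less than n/k, whence |C_{k-1}| ≤ (k-1)(n/k² + n/k) = n - n/k² and the
-- complement of C_{k-1} still has at least n/k² vertices. The layers C_{i+1} ∖ C_i together
-- with V ∖ C_{k-1} form the complete blockade.
module Submission where

open import Defs hiding (sym)
open import Data.Bool using (true; false)
import Data.Bool as Bool
open import Data.Fin using (Fin; _≟_) renaming (zero to fzero; suc to fsuc)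
open import Data.Fin.Properties using (any?)
open import Data.Fin.Subset
  using (Subset; _∈_; _∉_; ∣_∣; _∪_; _─_; ∁; ⁅_⁆; ⊥; ⊤; _⊆_; _⊂_; _⊃_; inside; outside)
open import Data.Fin.Subset.Properties
  using (_∈?_; nonempty?; ∉⊥; x∈⁅x⁆; x∈⁅y⁆⇒x≡y; x∈∁p⇒x∉p; x∉∁p⇒x∈p; x∈p∪q⁺; x∈p∪q⁻;
         x∈p∧x∉q⇒x∈p─q; p⊆p∪q; p─q⊆p; p⊆q⇒∣p∣≤∣q∣; ∣p∣≤n; ∣⊤∣≡n; ∣⊥∣≡0; ∣∁p∣≡n∸∣p∣)
open import Data.Fin.Subset.Induction using (⊃-wellFounded; Acc; acc)
open import Data.Nat using (ℕ; zero; suc; _≤_; _<_; _*_; _+_; s≤s; z≤n)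
open import Data.Nat.Properties
  using (≤-refl; ≤-reflexive; ≤-trans; <-≤-trans; <⇒≤; <⇒≱; ≰⇒>; _≤?_; n≤1+n; m≤m+n; m∸n+n≡m;
         +-assoc; +-comm; +-suc; +-identityʳ; +-mono-≤; +-monoˡ-≤; +-monoʳ-≤; +-cancelˡ-≤;
         *-assoc; *-zeroʳ; *-distribˡ-+; *-monoʳ-≤; *-cancelˡ-<; module ≤-Reasoning)
open import Data.Nat.Solver using (module +-*-Solver)
open import Data.Product using (Σ; ∃; _×_; _,_)
open import Data.Sum using (_⊎_; inj₁; inj₂)
open import Data.Vec using ([]; _∷_; there)
import Data.Vec.Functional as Vector
open import Relation.Nullary using (Dec; yes; no; contradiction)
open import Relation.Nullary.Decidable using (¬?; _×-dec_)
open import Relation.Binary.PropositionalEquality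
  using (_≡_; _≢_; refl; sym; trans; cong; module ≡-Reasoning)

∣p∪q∣≤∣p∣+∣q∣ : ∀ {n} (p q : Subset n) → ∣ p ∪ q ∣ ≤ ∣ p ∣ + ∣ q ∣
∣p∪q∣≤∣p∣+∣q∣ []            []            = z≤n
∣p∪q∣≤∣p∣+∣q∣ (inside  ∷ p) (inside  ∷ q) =
  s≤s (≤-trans (∣p∪q∣≤∣p∣+∣q∣ p q) (+-monoʳ-≤ ∣ p ∣ (n≤1+n ∣ q ∣)))
∣p∪q∣≤∣p∣+∣q∣ (inside  ∷ p) (outside ∷ q) = s≤s (∣p∪q∣≤∣p∣+∣q∣ p q)
∣p∪q∣≤∣p∣+∣q∣ (outside ∷ p) (inside  ∷ q) =
  ≤-trans (s≤s (∣p∪q∣≤∣p∣+∣q∣ p q)) (≤-reflexive (sym (+-suc ∣ p ∣ ∣ q ∣)))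
∣p∪q∣≤∣p∣+∣q∣ (outside ∷ p) (outside ∷ q) = ∣p∪q∣≤∣p∣+∣q∣ p q

∣p∣≤∣p─q∣+∣q∣ : ∀ {n} (p q : Subset n) → ∣ p ∣ ≤ ∣ p ─ q ∣ + ∣ q ∣
∣p∣≤∣p─q∣+∣q∣ p q = ≤-trans (p⊆q⇒∣p∣≤∣q∣ p⊆p─q∪q) (∣p∪q∣≤∣p∣+∣q∣ (p ─ q) q)
  where
  p⊆p─q∪q : p ⊆ (p ─ q) ∪ q
  p⊆p─q∪q {x} x∈p with x ∈? q
  ... | yes x∈q = x∈p∪q⁺ (inj₂ x∈q)
  ... | no  x∉q = x∈p∪q⁺ (inj₁ (x∈p∧x∉q⇒x∈p─q x∈p x∉q))

x∈p─q⇒x∉q : ∀ {n} {p q : Subset n} {x} → x ∈ p ─ q → x ∉ q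
x∈p─q⇒x∉q {p = _ ∷ _} {inside  ∷ _} {fzero}  ()        _
x∈p─q⇒x∉q {p = _ ∷ _} {outside ∷ _} {fzero}  _         ()
x∈p─q⇒x∉q {p = _ ∷ _} {_       ∷ _} {fsuc x} (there m) (there x∈q) = x∈p─q⇒x∉q m x∈q

x∈q∧x∉p⇒p⊂p∪q : ∀ {n} {p q : Subset n} {x} → x ∈ q → x ∉ p → p ⊂ p ∪ q
x∈q∧x∉p⇒p⊂p∪q {q = q} {x} x∈q x∉p = p⊆p∪q q , x , x∈p∪q⁺ (inj₂ x∈q) , x∉p

∣p∣<n⇒∃∉ : ∀ {n} {p : Subset n} → ∣ p ∣ < n → ∃ λ x → x ∉ p
∣p∣<n⇒∃∉ {n} {p} ∣p∣<n with nonempty? (∁ p)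
... | yes (x , x∈∁p) = x , x∈∁p⇒x∉p x∈∁p
... | no  ∁p-empty   = contradiction n≤∣p∣ (<⇒≱ ∣p∣<n)
  where
  ⊤⊆p : ⊤ ⊆ p
  ⊤⊆p {x} _ = x∉∁p⇒x∈p (λ x∈∁p → ∁p-empty (x , x∈∁p))
  n≤∣p∣ : n ≤ ∣ p ∣
  n≤∣p∣ = ≤-trans (≤-reflexive (sym (∣⊤∣≡n n))) (p⊆q⇒∣p∣≤∣q∣ ⊤⊆p)

module _ {n} {P Q : Subset n → Set}
         (extend : ∀ {D} → P D → Q D ⊎ ∃ λ D′ → D ⊂ D′ × P D′) where

  grow-until : ∀ {D} → P D → ∃ λ D′ → P D′ × Q D′
  grow-until {D} = go (⊃-wellFounded D)
    where
    go : ∀ {D} → Acc _⊃_ D → P D → ∃ λ D′ → P D′ × Q D′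
    go {D} (acc larger) pD with extend pD
    ... | inj₁ qD                = D , pD , qD
    ... | inj₂ (D′ , D⊂D′ , pD′) = go (larger D⊂D′) pD′

*-gap-≤ : ∀ d a b c {x} → d * a + x ≤ d * b → b ≤ c + a → x ≤ d * c
*-gap-≤ d a b c {x} lower b≤c+a = +-cancelˡ-≤ (d * a) x (d * c) (begin
  d * a + x     ≤⟨ lower ⟩
  d * b         ≤⟨ *-monoʳ-≤ d b≤c+a ⟩
  d * (c + a)   ≡⟨ *-distribˡ-+ d c a ⟩
  d * c + d * a ≡⟨ +-comm (d * c) (d * a) ⟩
  d * a + d * c ∎)
  where open ≤-Reasoning

module _ {n} (G : Graph n) where

  coAdj? : ∀ u w → Dec (CoAdj G u w)
  coAdj? u w = ¬? (u ≟ w) ×-dec (adj G u w Bool.≟ false)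

  CoClosed : Subset n → Set
  CoClosed C = ∀ {u w} → u ∈ C → CoAdj G u w → w ∈ C

  ⊥-coClosed : CoClosed ⊥
  ⊥-coClosed u∈⊥ = contradiction u∈⊥ ∉⊥

  ∪-coClosed : ∀ {C D} → CoClosed C → CoClosed D → CoClosed (C ∪ D)
  ∪-coClosed {C} {D} cC cD u∈C∪D uw with x∈p∪q⁻ C D u∈C∪D
  ... | inj₁ u∈C = x∈p∪q⁺ (inj₁ (cC u∈C uw))
  ... | inj₂ u∈D = x∈p∪q⁺ (inj₂ (cD u∈D uw))

  coClosed⇒adj : ∀ {C u w} → CoClosed C → u ∈ C → w ∉ C → adj G u w ≡ true
  coClosed⇒adj {u = u} {w} cC u∈C w∉C with adj G u w in uw
  ... | true  = refl
  ... | false with u ≟ w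
  ...   | yes refl = contradiction u∈C w∉C
  ...   | no  u≢w  = contradiction (cC u∈C (u≢w , uw)) w∉C

  anticomponent : ∀ v → ∃ λ K → v ∈ K × CoClosed K × (∀ u → u ∈ K → CoReach G v u)
  anticomponent v =
    let K , (v∈K , reach) , closed = grow-until close (x∈⁅x⁆ v , reach-⁅v⁆)
    in K , v∈K , closed , reach
    where
    Reached : Subset n → Set
    Reached K = v ∈ K × (∀ u → u ∈ K → CoReach G v u)

    reach-⁅v⁆ : ∀ u → u ∈ ⁅ v ⁆ → CoReach G v u
    reach-⁅v⁆ u u∈⁅v⁆ with x∈⁅y⁆⇒x≡y v u∈⁅v⁆
    ... | refl = here

    close : ∀ {K} → Reached K → CoClosed K ⊎ ∃ λ K′ → K ⊂ K′ × Reached K′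
    close {K} (v∈K , reach)
      with any? (λ u → any? (λ w → (u ∈? K) ×-dec (¬? (w ∈? K) ×-dec coAdj? u w)))
    ... | yes (u , w , u∈K , w∉K , uw) =
      inj₂ (K ∪ ⁅ w ⁆ , x∈q∧x∉p⇒p⊂p∪q (x∈⁅x⁆ w) w∉K , p⊆p∪q ⁅ w ⁆ v∈K , reach′)
      where
      reach′ : ∀ x → x ∈ K ∪ ⁅ w ⁆ → CoReach G v x
      reach′ x x∈ with x∈p∪q⁻ K ⁅ w ⁆ x∈
      ... | inj₁ x∈K = reach x x∈K
      ... | inj₂ x∈⁅w⁆ with x∈⁅y⁆⇒x≡y w x∈⁅w⁆
      ...   | refl = step (reach u u∈K) uw
    ... | no no-escape = inj₁ closed
      where
      closed : CoClosed K
      closed {u} {w} u∈K uw with w ∈? K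
      ... | yes w∈K = w∈K
      ... | no  w∉K = contradiction (u , w , u∈K , w∉K , uw) no-escape

emptyBlockade : ∀ {n} (G : Graph n) → Blockade G
emptyBlockade G = record { len = 0 ; block = Vector.[] ; disjoint = λ () }

module _ {n} {G : Graph n} where

  prepend : (X : Subset n) (B : Blockade G) → (∀ i {u} → u ∈ X → u ∉ block B i) → Blockade G
  prepend X B X#B = record { len = 1 + len B ; block = X Vector.∷ block B ; disjoint = disjoint′ }
    where
    disjoint′ : ∀ i j → i ≢ j → ∀ u → u ∈ (X Vector.∷ block B) i → u ∉ (X Vector.∷ block B) j
    disjoint′ fzero    fzero    i≢j = contradiction refl i≢j
    disjoint′ fzero    (fsuc j) _   u u∈X u∈Bj = X#B j u∈X u∈Bj
    disjoint′ (fsuc i) fzero    _   u u∈Bi u∈X = X#B i u∈X u∈Bi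
    disjoint′ (fsuc i) (fsuc j) i≢j = disjoint B i j (λ i≡j → i≢j (cong fsuc i≡j))

  module _ (X : Subset n) (B : Blockade G) (X#B : ∀ i {u} → u ∈ X → u ∉ block B i) where

    prepend-wide : ∀ d → n ≤ d * ∣ X ∣ → WidthAtLeastFrac B d →
                   WidthAtLeastFrac (prepend X B X#B) d
    prepend-wide d X-wide B-wide fzero    = X-wide
    prepend-wide d X-wide B-wide (fsuc i) = B-wide i

    prepend-complete : (∀ i {u w} → u ∈ X → w ∈ block B i → adj G u w ≡ true) →
                       Complete B → Complete (prepend X B X#B)
    prepend-complete X-B B-complete fzero    fzero    i≢j = contradiction refl i≢j
    prepend-complete X-B B-complete fzero    (fsuc j) _   u w u∈X w∈Bj = X-B j u∈X w∈Bj
    prepend-complete X-B B-complete (fsuc i) fzero    _   u w u∈Bi w∈X =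
      trans (Graph.sym G u w) (X-B i w∈X u∈Bi)
    prepend-complete X-B B-complete (fsuc i) (fsuc j) i≢j =
      B-complete i j (λ i≡j → i≢j (cong fsuc i≡j))

module Layering (k : ℕ) {n} (G : Graph n) (small : SmallAnticomponents G k) where

  next-layer : ∀ {C} → CoClosed G C → k * k * ∣ C ∣ + n ≤ k * k * n →
    ∃ λ E → CoClosed G E × C ⊆ E ×
            k * k * ∣ C ∣ + n ≤ k * k * ∣ E ∣ × k * k * ∣ E ∣ ≤ k * k * ∣ C ∣ + (n + k * n)
  next-layer {C} cC room =
    let E , (cE , C⊆E , upper) , lower =
          grow-until add-anticomponent (cC , (λ x∈C → x∈C) , m≤m+n _ _)
    in E , cE , C⊆E , lower , upper
    where
    Admissible : Subset n → Set
    Admissible D = CoClosed G D × C ⊆ D × k * k * ∣ D ∣ ≤ k * k * ∣ C ∣ + (n + k * n)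

    add-anticomponent : ∀ {D} → Admissible D →
      k * k * ∣ C ∣ + n ≤ k * k * ∣ D ∣ ⊎ ∃ λ D′ → D ⊂ D′ × Admissible D′
    add-anticomponent {D} (cD , C⊆D , upper) with k * k * ∣ C ∣ + n ≤? k * k * ∣ D ∣
    ... | yes lower = inj₁ lower
    ... | no  short =
      let v , v∉D = ∣p∣<n⇒∃∉ ∣D∣<n
          K , v∈K , cK , reach = anticomponent G v
      in inj₂ (D ∪ K , x∈q∧x∉p⇒p⊂p∪q v∈K v∉D , ∪-coClosed G cD cK ,
               (λ x∈C → p⊆p∪q K (C⊆D x∈C)) , ∪-upper K (small v K reach))
      where
      short′ : k * k * ∣ D ∣ < k * k * ∣ C ∣ + n
      short′ = ≰⇒> short

      ∣D∣<n : ∣ D ∣ < n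
      ∣D∣<n = *-cancelˡ-< (k * k) ∣ D ∣ n (<-≤-trans short′ room)

      ∪-upper : ∀ K → k * ∣ K ∣ < n → k * k * ∣ D ∪ K ∣ ≤ k * k * ∣ C ∣ + (n + k * n)
      ∪-upper K small-K = begin
        k * k * ∣ D ∪ K ∣                  ≤⟨ *-monoʳ-≤ (k * k) (∣p∪q∣≤∣p∣+∣q∣ D K) ⟩
        k * k * (∣ D ∣ + ∣ K ∣)            ≡⟨ *-distribˡ-+ (k * k) ∣ D ∣ ∣ K ∣ ⟩
        k * k * ∣ D ∣ + k * k * ∣ K ∣      ≡⟨ cong (k * k * ∣ D ∣ +_) (*-assoc k k ∣ K ∣) ⟩
        k * k * ∣ D ∣ + k * (k * ∣ K ∣)    ≤⟨ +-mono-≤ (<⇒≤ short′) (*-monoʳ-≤ k (<⇒≤ small-K)) ⟩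
        k * k * ∣ C ∣ + n + k * n          ≡⟨ +-assoc (k * k * ∣ C ∣) n (k * n) ⟩
        k * k * ∣ C ∣ + (n + k * n)        ∎
        where open ≤-Reasoning

  record LayeredBlockade (m : ℕ) (C : Subset n) : Set where
    field
      blockade : Blockade G
      long     : m ≤ len blockade
      wide     : WidthAtLeastFrac blockade (k * k)
      complete : Complete blockade
      avoids   : ∀ i {u} → u ∈ block blockade i → u ∉ C

  -- All sizes are scaled by k²: a grown layer costs at most n + k n (that is, n/k² + n/k
  -- vertices) and the final block V ∖ C needs n.
  layers : ∀ m {C} → CoClosed G C → k * k * ∣ C ∣ + m * (n + k * n) + n ≤ k * k * n →
           LayeredBlockade (1 + m) C
  layers zero {C} _ room = record
    { blockade = prepend (∁ C) (emptyBlockade G) ∁C#∅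
    ; long     = ≤-refl
    ; wide     = prepend-wide (∁ C) (emptyBlockade G) ∁C#∅ (k * k)
                   (*-gap-≤ (k * k) ∣ C ∣ n (∣ ∁ C ∣) room′ n≤∣∁C∣+∣C∣) (λ ())
    ; complete = prepend-complete (∁ C) (emptyBlockade G) ∁C#∅ (λ ()) (λ ())
    ; avoids   = λ { fzero → x∈∁p⇒x∉p ; (fsuc ()) }
    }
    where
    ∁C#∅ : ∀ i {u} → u ∈ ∁ C → u ∉ block (emptyBlockade G) i
    ∁C#∅ ()

    room′ : k * k * ∣ C ∣ + n ≤ k * k * n
    room′ = ≤-trans (≤-reflexive (cong (_+ n) (sym (+-identityʳ (k * k * ∣ C ∣))))) room

    n≤∣∁C∣+∣C∣ : n ≤ ∣ ∁ C ∣ + ∣ C ∣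
    n≤∣∁C∣+∣C∣ =
      ≤-reflexive (sym (trans (cong (_+ ∣ C ∣) (∣∁p∣≡n∸∣p∣ C)) (m∸n+n≡m (∣p∣≤n C))))
  layers (suc m) {C} cC room with next-layer cC (≤-trans (+-monoˡ-≤ n (m≤m+n _ _)) room)
  ... | E , cE , C⊆E , lower , upper = record
    { blockade = prepend (E ─ C) blockade E─C#B
    ; long     = s≤s long
    ; wide     = prepend-wide (E ─ C) blockade E─C#B (k * k)
                   (*-gap-≤ (k * k) ∣ C ∣ (∣ E ∣) (∣ E ─ C ∣) lower (∣p∣≤∣p─q∣+∣q∣ E C)) wide
    ; complete = prepend-complete (E ─ C) blockade E─C#B E─C→B complete
    ; avoids   = λ { fzero → x∈p─q⇒x∉q ; (fsuc i) u∈Bi u∈C → avoids i u∈Bi (C⊆E u∈C) }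
    }
    where
    X = n + k * n

    room′ : k * k * ∣ E ∣ + m * X + n ≤ k * k * n
    room′ = ≤-trans (+-monoˡ-≤ n (+-monoˡ-≤ (m * X) upper))
              (≤-trans (≤-reflexive (cong (_+ n) (+-assoc (k * k * ∣ C ∣) X (m * X)))) room)

    open LayeredBlockade (layers m cE room′)

    E─C#B : ∀ i {u} → u ∈ E ─ C → u ∉ block blockade i
    E─C#B i u∈E─C u∈Bi = avoids i u∈Bi (p─q⊆p E C u∈E─C)

    E─C→B : ∀ i {u w} → u ∈ E ─ C → w ∈ block blockade i → adj G u w ≡ true
    E─C→B i u∈E─C w∈Bi = coClosed⇒adj G cE (p─q⊆p E C u∈E─C) (avoids i w∈Bi)

layer-budget : ∀ m n → m * (n + (1 + m) * n) + n ≡ (1 + m) * (1 + m) * n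
layer-budget = solve 2 (λ m n → m :* (n :+ (con 1 :+ m) :* n) :+ n
                               := (con 1 :+ m) :* (con 1 :+ m) :* n) refl
  where open +-*-Solver

lemma4p1 : (k : ℕ) → 2 ≤ k → (n : ℕ) → (G : Graph n) → SmallAnticomponents G k →
    Σ (Blockade G) (λ B → (k ≤ len B) × (WidthAtLeastFrac B (k * k) × Complete B))
lemma4p1 k@(suc (suc m)) (s≤s (s≤s z≤n)) n G small = blockade , long , wide , complete
  where
  open Layering k G small

  room : k * k * ∣ ⊥ {n} ∣ + suc m * (n + k * n) + n ≤ k * k * n
  room = ≤-reflexive (begin
    k * k * ∣ ⊥ {n} ∣ + S + n ≡⟨ cong (λ z → k * k * z + S + n) (∣⊥∣≡0 n) ⟩
    k * k * 0 + S + n         ≡⟨ cong (λ z → z + S + n) (*-zeroʳ (k * k)) ⟩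
    S + n                     ≡⟨ layer-budget (suc m) n ⟩
    k * k * n                 ∎)
    where
    S = suc m * (n + k * n)
    open ≡-Reasoning

  open LayeredBlockade (layers (suc m) (⊥-coClosed G) room)
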